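{- Let $A$ be a finite set of prisoners with $|A|\ge2$, let $K$ be a set of colors with $|K|=2$, let $V$ be a visibility graph on $A$, and let $I$ be an inning function on $A$ with $IN\ge2$. Suppose the hat game $\mathcal{G}=(A,K,V,I)$ satisfies: (S4) every prisoner $a\in I_1$ sees all other hats: $V(a)=A\setminus\{a\}$; (S5) exactly two prisoners declare in the first inning: $|I_1|=2$; (S6) for every $n\in\{2,\dots,IN\}$ and every $a\in I_n$, $I_1\cup (I_{n- }\setminus\{a\})\subseteq V(a)$. Then there is a predictor $P$ for $\mathcal{G}$ such that for every coloring $f\in K^A$, at most one prisoner guesses incorrectly.
   Context: A hat game $(A,K,V,I)$ consists of: a set $A$ of prisoners and a set $K$ of colors (with $|A|,|K|\ge2$); a visibility graph $V\subseteq A^2$ with no loops, where $(a,b)\in V$ means $a$ sees $b$'s hat, and $V(a)=\{b:(a,b)\in V\}$; and an inning function $I$, a surjection from $A$ onto $\{\beta:1\le\beta\le\alpha\}$ for some nonzero ordinal $\alpha$. Write $IN=\max\operatorname{ran}(I)$, $I_\beta=\{a:I(a)=\beta\}$, $I_{n- }=\bigcup_{n\le\beta\le IN}I_\beta$, and $H(a)=\{b:I(b)<I(a)\}$. A coloring is $f\in K^A$. Strategies: for each $a$, a function $S_a:K^{H(a)}\times K^{V(a)}\to K$; the guess is defined by recursion on $I(a)$ as $\sigma_a(f)=S_a(h_a^f,f\restriction V(a))$ with $h_a^f=(\sigma_b(f))_{b\in H(a)}$. A predictor is $P:K^A\to K^A$ with $P(f)(a)=\sigma_a(f)$ for some family of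 strategies. Prisoner $a$ guesses incorrectly under $f$ if $P(f)(a)\ne f(a)$. -}

module Defs where

open import Data.Nat using (ℕ; _≤_; _<_)
open import Data.Fin using (Fin)
open import Data.Bool using (Bool; true; false)
open import Data.Product using (Σ; ∃; _×_)
open import Data.Sum using (_⊎_)
open import Relation.Binary.PropositionalEquality using (_≡_; _≢_)

-- Prisoners: A = Fin n.  Colors: K = Bool (|K| = 2).
-- Visibility graph: V a b ≡ true  means  a sees b's hat.
Visibility : ℕ → Set
Visibility n = Fin n → Fin n → Bool

NoLoops : ∀ {n} → Visibility n → Set
NoLoops {n} V = ∀ (a : Fin n) → V a a ≡ false

-- Inning function I : A → {1,…,IN}, surjective onto {β : 1 ≤ β ≤ IN}
-- (A finite, so the ordinal α = IN is a natural number).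
IsInning : ∀ {n} → (Fin n → ℕ) → ℕ → Set
IsInning {n} I IN =
  (∀ (a : Fin n) → 1 ≤ I a × I a ≤ IN) ×
  (∀ (β : ℕ) → 1 ≤ β → β ≤ IN → ∃ λ (a : Fin n) → I a ≡ β)

Coloring : ℕ → Set
Coloring n = Fin n → Bool

Strategies : ∀ {n} → Visibility n → (Fin n → ℕ) → Set
Strategies {n} V I =
  (a : Fin n) →
  ((b : Fin n) → I b < I a → Bool) →
  ((b : Fin n) → V a b ≡ true → Bool) →
  Bool

-- The recursion on I(a)
-- has a unique solution, characterized by these equations.
InducedBy : ∀ {n} (V : Visibility n) (I : Fin n → ℕ) →
            Strategies V I → (Coloring n → Coloring n) → Set
InducedBy {n} V I S P =
  ∀ (f : Coloring n) (a : Fin n) →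
    P f a ≡ S a (λ b _ → P f b) (λ b _ → f b)

IsPredictor : ∀ {n} (V : Visibility n) (I : Fin n → ℕ) →
              (Coloring n → Coloring n) → Set
IsPredictor V I P = Σ (Strategies V I) λ S → InducedBy V I S P

Wrong : ∀ {n} → (Coloring n → Coloring n) → Coloring n → Fin n → Set
Wrong P f a = P f a ≢ f a

S4 : ∀ {n} → Visibility n → (Fin n → ℕ) → Set
S4 {n} V I = ∀ (a b : Fin n) → I a ≡ 1 → a ≢ b → V a b ≡ true

S5 : ∀ {n} → (Fin n → ℕ) → Set
S5 {n} I = Σ (Fin n) λ a₁ → Σ (Fin n) λ a₂ →
  a₁ ≢ a₂ × I a₁ ≡ 1 × I a₂ ≡ 1 ×
  (∀ (c : Fin n) → I c ≡ 1 → c ≡ a₁ ⊎ c ≡ a₂)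

S6 : ∀ {n} → Visibility n → (Fin n → ℕ) → ℕ → Set
S6 {n} V I IN = ∀ (m : ℕ) → 2 ≤ m → m ≤ IN → ∀ (a : Fin n) → I a ≡ m →
  ∀ (b : Fin n) → (I b ≡ 1 ⊎ (m ≤ I b × I b ≤ IN × b ≢ a)) → V a b ≡ true

-- The two first-inning prisoners bet on opposite values of the parity of all
-- hats: a₁ announces the hat that would make it even, a₂ the one that would make
-- it odd, so one of them is right.  Every later prisoner a hears a₁'s
-- announcement and knows every hat but his own: the hats he does not see belong
-- to earlier innings, where everyone except a₁, a₂ has guessed correctly.  As
-- a₁'s announcement is the parity of all hats but a₁'s, a recovers his own hat.
module Submission where

open import Defs
open import Algebra.Bundles using (CommutativeRing)
open import Data.Bool using (Bool; true; false; not; _xor_; if_then_else_)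
open import Data.Bool.Properties using (xor-∧-commutativeRing; xor-assoc; xor-same; xor-identityʳ)
  renaming (_≟_ to _≟ᵇ_)
open import Data.Fin using (Fin; _≟_)
open import Data.Fin.Properties using (punchInᵢ≢i)
open import Data.Nat using (ℕ; suc; _≤_; _<_)
open import Data.Nat.Properties using (_<?_; ≰⇒>; ≤∧≢⇒<)
open import Data.Product using (Σ; _×_; _,_; proj₁; proj₂)
open import Data.Sum using (_⊎_; inj₁; inj₂)
open import Data.Vec.Functional using (updateAt; removeAt)
open import Data.Vec.Functional.Properties using (updateAt-updates; updateAt-minimal)
open import Function using (const)
open import Relation.Nullary using (Dec; yes; no; contradiction)
open import Relation.Binary.PropositionalEquality
  using (_≡_; _≢_; refl; sym; trans; cong; cong₂; subst; ≢-sym; module ≡-Reasoning)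
open import Algebra.Properties.CommutativeMonoid.Sum
  (CommutativeRing.+-commutativeMonoid xor-∧-commutativeRing)
  using (sum-remove; sum-cong-≗) renaming (sum to parity)

open ≡-Reasoning

xor-cancelʳ : ∀ x y → (x xor y) xor y ≡ x
xor-cancelʳ x y = begin
  (x xor y) xor y  ≡⟨ xor-assoc x y y ⟩
  x xor (y xor y)  ≡⟨ cong (x xor_) (xor-same y) ⟩
  x xor false      ≡⟨ xor-identityʳ x ⟩
  x                ∎

erase : ∀ {n} → Fin n → (Fin n → Bool) → Fin n → Bool
erase c g = updateAt g c (const false)

erase-≢ : ∀ {n} {c b : Fin n} (g : Fin n → Bool) → b ≢ c → erase c g b ≡ g b
erase-≢ g b≢c = updateAt-minimal _ _ g b≢c

erase-cong : ∀ {n} {g h : Fin n → Bool} (c b : Fin n) →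
             (b ≢ c → g b ≡ h b) → erase c g b ≡ erase c h b
erase-cong c b g≡h with b ≟ c
... | yes refl = trans (updateAt-updates b _) (sym (updateAt-updates b _))
... | no b≢c   = trans (erase-≢ _ b≢c) (trans (g≡h b≢c) (sym (erase-≢ _ b≢c)))

parity-erase : ∀ {n} (g : Fin n → Bool) (c : Fin n) →
               parity g ≡ g c xor parity (erase c g)
parity-erase {suc n} g c = begin
  parity g                                 ≡⟨ sum-remove {i = c} g ⟩
  g c xor parity (removeAt g c)            ≡⟨ cong (g c xor_) (sum-cong-≗ agree) ⟩
  g c xor parity (removeAt (erase c g) c)  ≡⟨ cong (g c xor_) erased ⟨
  g c xor parity (erase c g)               ∎
  where
  agree : ∀ j → removeAt g c j ≡ removeAt (erase c g) c j
  agree j = sym (erase-≢ g (punchInᵢ≢i c j))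
  erased : parity (erase c g) ≡ parity (removeAt (erase c g) c)
  erased = trans (sum-remove {i = c} (erase c g)) (cong₂ _xor_ (updateAt-updates c g) refl)

recover-entry : ∀ {n} (g : Fin n → Bool) (c : Fin n) {p : Bool} →
                parity g ≡ p → g c ≡ p xor parity (erase c g)
recover-entry g c {p} parity≡p = begin
  g c                                                  ≡⟨ xor-cancelʳ (g c) _ ⟨
  (g c xor parity (erase c g)) xor parity (erase c g)  ≡⟨ cong₂ _xor_ (parity-erase g c) refl ⟨
  parity g xor parity (erase c g)                      ≡⟨ cong₂ _xor_ parity≡p refl ⟩
  p xor parity (erase c g)                             ∎

if?_then_else_ : {P : Set} → Dec P → (P → Bool) → Bool → Bool
if? yes p then k else _ = k p
if? no _  then _ else x = x

if?-yes : {P : Set} (d : Dec P) {x y : Bool} → P → (if? d then const x else y) ≡ x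
if?-yes (yes _) _ = refl
if?-yes (no ¬p) p = contradiction p ¬p

module ParityStrategy
  {n : ℕ} (V : Visibility n) (I : Fin n → ℕ) {IN : ℕ}
  (bounds : ∀ a → 1 ≤ I a × I a ≤ IN) (s4 : S4 V I) (s6 : S6 V I IN)
  (a₁ a₂ : Fin n) (I₁ : I a₁ ≡ 1) (I₂ : I a₂ ≡ 1)
  (first-inning : ∀ c → I c ≡ 1 → c ≡ a₁ ⊎ c ≡ a₂)
  where

  guess : Fin n → (Fin n → Bool) → Bool → Bool
  guess a w announced with a ≟ a₁ | a ≟ a₂
  ... | yes _ | _     = parity (erase a w)
  ... | no _  | yes _ = not (parity (erase a w))
  ... | no _  | no _  = announced xor parity (erase a (erase a₁ w))

  -- A seen hat takes priority over a heard guess, since a₂'s guess may be wrong.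
  knowledge : (a : Fin n) → ((b : Fin n) → I b < I a → Bool) →
              ((b : Fin n) → V a b ≡ true → Bool) → Fin n → Bool
  knowledge a h v b = if? V a b ≟ᵇ true then v b else (if? I b <? I a then h b else false)

  strategy : Strategies V I
  strategy a h v = guess a (knowledge a h v) (if? I a₁ <? I a then h a₁ else false)

  predictor : Coloring n → Coloring n
  predictor f a = guess a f (parity (erase a₁ f))

  guess-cong : ∀ a {w w′ x x′} → (∀ b → b ≢ a → w b ≡ w′ b) →
               (a ≢ a₁ → a ≢ a₂ → x ≡ x′) → guess a w x ≡ guess a w′ x′
  guess-cong a w≡w′ x≡x′ with a ≟ a₁ | a ≟ a₂
  ... | yes _     | _         = sum-cong-≗ λ b → erase-cong a b (w≡w′ b)
  ... | no _      | yes _     = cong not (sum-cong-≗ λ b → erase-cong a b (w≡w′ b))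
  ... | no a≢a₁   | no a≢a₂   = cong₂ _xor_ (x≡x′ a≢a₁ a≢a₂) (sum-cong-≗ λ b →
          erase-cong a b λ b≢a → erase-cong a₁ b λ _ → w≡w′ b b≢a)

  later-inning : ∀ a → I a ≢ 1 → 2 ≤ I a
  later-inning a Ia≢1 = ≤∧≢⇒< (proj₁ (bounds a)) (≢-sym Ia≢1)

  predictor-a₁ : ∀ f → predictor f a₁ ≡ parity (erase a₁ f)
  predictor-a₁ f with a₁ ≟ a₁
  ... | yes _  = refl
  ... | no ≢a₁ = contradiction refl ≢a₁

  recover-from-announcement : ∀ f b → b ≢ a₁ →
                              parity (erase a₁ f) xor parity (erase b (erase a₁ f)) ≡ f b
  recover-from-announcement f b b≢a₁ = begin
    parity (erase a₁ f) xor parity (erase b (erase a₁ f))  ≡⟨ recover-entry (erase a₁ f) b refl ⟨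
    erase a₁ f b                                           ≡⟨ erase-≢ f b≢a₁ ⟩
    f b                                                    ∎

  predictor-later : ∀ f b → b ≢ a₁ → b ≢ a₂ → predictor f b ≡ f b
  predictor-later f b b≢a₁ b≢a₂ with b ≟ a₁ | b ≟ a₂
  ... | yes b≡a₁ | _        = contradiction b≡a₁ b≢a₁
  ... | no _     | yes b≡a₂ = contradiction b≡a₂ b≢a₂
  ... | no _     | no _     = recover-from-announcement f b b≢a₁

  knowledge-correct : ∀ f a b → b ≢ a →
                      knowledge a (λ c _ → predictor f c) (λ c _ → f c) b ≡ f b
  knowledge-correct f a b b≢a with V a b ≟ᵇ true
  ... | yes _     = refl
  ... | no unseen =
    trans (if?-yes (I b <? I a) earlier)
          (predictor-later f b (λ { refl → b∉I₁ I₁ }) (λ { refl → b∉I₁ I₂ }))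
    where
    sees : I b ≡ 1 ⊎ (I a ≤ I b × I b ≤ IN × b ≢ a) → V a b ≡ true
    sees = s6 (I a) (later-inning a λ Ia≡1 → unseen (s4 a b Ia≡1 (≢-sym b≢a)))
              (proj₂ (bounds a)) a refl b
    earlier : I b < I a
    earlier = ≰⇒> λ Ia≤Ib → unseen (sees (inj₂ (Ia≤Ib , proj₂ (bounds b) , b≢a)))
    b∉I₁ : I b ≢ 1
    b∉I₁ Ib≡1 = unseen (sees (inj₁ Ib≡1))

  predictor-induced : InducedBy V I strategy predictor
  predictor-induced f a =
    guess-cong a (λ b b≢a → sym (knowledge-correct f a b b≢a)) hears-a₁
    where
    hears-a₁ : a ≢ a₁ → a ≢ a₂ →
               parity (erase a₁ f) ≡ (if? I a₁ <? I a then const (predictor f a₁) else false)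
    hears-a₁ a≢a₁ a≢a₂ = sym (trans (if?-yes (I a₁ <? I a) a₁-earlier) (predictor-a₁ f))
      where
      a∉I₁ : I a ≢ 1
      a∉I₁ Ia≡1 with first-inning a Ia≡1
      ... | inj₁ a≡a₁ = a≢a₁ a≡a₁
      ... | inj₂ a≡a₂ = a≢a₂ a≡a₂
      a₁-earlier : I a₁ < I a
      a₁-earlier = subst (_< I a) (sym I₁) (later-inning a a∉I₁)

  wrong⇒suspect : ∀ f c → Wrong predictor f c → c ≡ (if parity f then a₁ else a₂)
  wrong⇒suspect f c wrong with c ≟ a₁ | c ≟ a₂ | parity f in parity≡
  ... | no c≢a₁  | no _     | _     = contradiction (recover-from-announcement f c c≢a₁) wrong
  ... | yes refl | _        | true  = refl
  ... | yes refl | _        | false = contradiction (sym (recover-entry f c parity≡)) wrong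
  ... | no _     | yes refl | false = refl
  ... | no _     | yes refl | true  = contradiction (sym (recover-entry f c parity≡)) wrong

  at-most-one-wrong : ∀ f a b → Wrong predictor f a → Wrong predictor f b → a ≡ b
  at-most-one-wrong f a b wrong-a wrong-b =
    trans (wrong⇒suspect f a wrong-a) (sym (wrong⇒suspect f b wrong-b))

theorem4p2 : (n : ℕ) → 2 ≤ n →
    (V : Visibility n) → NoLoops V →
    (I : Fin n → ℕ) → (IN : ℕ) → IsInning I IN → 2 ≤ IN →
    S4 V I → S5 I → S6 V I IN →
    Σ (Coloring n → Coloring n) λ P → IsPredictor V I P ×
      (∀ (f : Coloring n) (a b : Fin n) → Wrong P f a → Wrong P f b → a ≡ b)
theorem4p2 n _ V _ I IN (bounds , _) _ s4 (a₁ , a₂ , _ , I₁ , I₂ , first-inning) s6 =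
  predictor , (strategy , predictor-induced) , at-most-one-wrong
  where open ParityStrategy V I bounds s4 s6 a₁ a₂ I₁ I₂ first-inning
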